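{- For every partition $\lambda$ and positive integer $n$, the degree of $G_\lambda(\mathbf{x}_n;\mathbf{t};\mathbf{w})$ (as a polynomial in $x_1,\ldots,x_n$) equals $|\bar\lambda^{(n)}|=\sum_i\bar\lambda^{(n)}_i$.
   Context: Boxes are $(i,j)$ (row $i$, column $j$). $\mathrm{SVRPP}^n(\lambda)$: fillings $T$ of the Young diagram of $\lambda$ by nonempty subsets $T(i,j)\subseteq[n]$ weakly increasing along rows and down columns ($A\le B$ meaning $\max A\le\min B$). $\mathrm{ircont}(T)=(r_1,\ldots,r_n)$, $r_k$ = number of columns containing a box whose set contains $k$; $\mathrm{ceq}(T)=(c_i)$, $c_i$ = number of boxes $(i,j)$ with $(i+1,j)\in\lambda$ and $\max T(i,j)=\min T(i+1,j)$; $\mathrm{ex}(T)=(e_i)$, $e_i=\sum_j(|T(i,j)|-1)$ over row $i$. $G_\lambda(\mathbf{x}_n;\mathbf{t};\mathbf{w})=\sum_{T\in\mathrm{SVRPP}^n(\lambda)}\mathbf{x}^{\mathrm{ircont}(T)}\mathbf{t}^{\mathrm{ceq}(T)}\mathbf{w}^{\mathrm{ex}(T)}$ with $\mathbf{y}^\alpha=\prod_k y_k^{\alpha_k}$. Define $\lambda^\flat$ by $\lambda^\flat_1=\lambda_1$ and $\lambda^\flat_i=\max\{0,\min\{\lambda^\flat_{i-1}-1,\lambda_i\}\}$ for $i\ge2$; let $k$ be its number of positive parts. $\bar\lambda^{(n)}=(\bar\lambda^{(n)}_1,\ldots,\bar\lambda^{(n)}_n)$: if $n\le k$, $\bar\lambda^{(n)}_i=\lambda^\flat_i+i-1$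 for $i\le n$; if $n>k$, $\bar\lambda^{(n)}_i=\lambda^\flat_i+i-1$ for $i\le k$ and $\bar\lambda^{(n)}_i=k$ for $k<i\le n$. -}

module Defs where

open import Data.Nat using (ℕ; zero; suc; _+_; _∸_; _⊓_; _<_; _≤_; _<ᵇ_)
open import Data.Bool using (Bool; true; false; _∧_; _∨_; if_then_else_)
open import Data.Fin using (Fin)
import Data.Fin as F
open import Data.Fin.Subset using (Subset; _∈_; Nonempty)
open import Data.Vec using (lookup)
open import Data.List using (List; []; _∷_; length)
open import Data.List.Relation.Unary.All using (All)
open import Data.List.Relation.Unary.Linked using (Linked)
open import Relation.Binary.PropositionalEquality using (_≡_)
open import Data.Product using (Σ; _×_; ∃)

IsPartition : List ℕ → Set
IsPartition λ′ = Linked (λ a b → b ≤ a) λ′ × All (0 <_) λ′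

-- i-th part (0-indexed), 0 beyond the length.
part : List ℕ → ℕ → ℕ
part []       _       = 0
part (x ∷ _)  zero    = x
part (_ ∷ xs) (suc i) = part xs i

InDiagram : List ℕ → ℕ → ℕ → Set
InDiagram λ′ i j = j < part λ′ i

_≤ₛ_ : ∀ {n} → Subset n → Subset n → Set
A ≤ₛ B = ∀ a b → a ∈ A → b ∈ B → a F.≤ b

-- Fillings are functions on ℕ × ℕ (0-indexed boxes); only values on boxes
-- of the diagram matter.
Filling : ℕ → Set
Filling n = ℕ → ℕ → Subset n

IsSVRPP : (n : ℕ) → List ℕ → Filling n → Set
IsSVRPP n λ′ T =
    (∀ i j → InDiagram λ′ i j → Nonempty (T i j))
  × (∀ i j → InDiagram λ′ i (suc j) → T i j ≤ₛ T i (suc j))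
  × (∀ i j → InDiagram λ′ (suc i) j → T i j ≤ₛ T (suc i) j)

anyBelow : ℕ → (ℕ → Bool) → Bool
anyBelow zero    p = false
anyBelow (suc m) p = anyBelow m p ∨ p m

countBelow : ℕ → (ℕ → Bool) → ℕ
countBelow zero    p = 0
countBelow (suc m) p = countBelow m p + (if p m then 1 else 0)

sumFin : ∀ n → (Fin n → ℕ) → ℕ
sumFin zero    f = 0
sumFin (suc n) f = f F.zero + sumFin n (λ k → f (F.suc k))

colContains : ∀ {n} → List ℕ → Filling n → Fin n → ℕ → Bool
colContains λ′ T k j = anyBelow (length λ′) (λ i → (j <ᵇ part λ′ i) ∧ lookup (T i j) k)

ircont : ∀ {n} → List ℕ → Filling n → Fin n → ℕ
ircont λ′ T k = countBelow (part λ′ 0) (colContains λ′ T k)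

ircontSize : ∀ n → List ℕ → Filling n → ℕ
ircontSize n λ′ T = sumFin n (ircont λ′ T)

-- G is a sum, with coefficient 1 each, of the
-- monomials x^{ircont T} t^{ceq T} w^{ex T} over T ∈ SVRPP^n(λ); no
-- cancellation can occur, so the monomials with nonzero coefficient are
-- exactly those of the fillings T.  Hence d is the degree in x iff every such
-- monomial has x-degree ≤ d and some has x-degree exactly d.
IsXDegreeOfG : (n : ℕ) → List ℕ → ℕ → Set
IsXDegreeOfG n λ′ d =
    (∀ T → IsSVRPP n λ′ T → ircontSize n λ′ T ≤ d)
  × (Σ (Filling n) λ T → IsSVRPP n λ′ T × (ircontSize n λ′ T ≡ d))

flatAux : ℕ → List ℕ → List ℕ
flatAux prev []       = []
flatAux prev (x ∷ xs) = ((prev ∸ 1) ⊓ x) ∷ flatAux ((prev ∸ 1) ⊓ x) xs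

flat : List ℕ → List ℕ
flat []       = []
flat (x ∷ xs) = x ∷ flatAux x xs

numPos : List ℕ → ℕ
numPos []            = 0
numPos (zero  ∷ xs)  = numPos xs
numPos (suc _ ∷ xs)  = suc (numPos xs)

-- |λ̄^(n)| = Σ_{i=1}^{n} λ̄^(n)_i ; with 0-indexed i:
--   λ̄_i = λ♭_i + i  if i < k,   = k  otherwise.
barSize : ℕ → List ℕ → ℕ
barSize n λ′ = go n
  where
  k = numPos (flat λ′)
  entry : ℕ → ℕ
  entry i = if i <ᵇ k then part (flat λ′) i + i else k
  go : ℕ → ℕ
  go zero    = 0
  go (suc m) = go m + entry m

{-# OPTIONS --safe #-}
module Submission where

-- Upper bound, by induction on n.  Let T be a filling with entries in [n+1].  The
-- boxes of T containing an entry ≤ n form a subdiagram ν ⊆ λ, and deleting n+1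
-- from them gives a filling of ν with entries in [n].  An entry k ≤ n occupies no
-- more columns than before, while n+1 only occupies columns meeting λ/ν or a
-- removable corner of ν ("border" columns).  So it suffices that
-- |ν̄^(n)| + #border ≤ |λ̄^(n+1)|.  Passing to λ♭ and ν♭ only adds border columns,
-- and for these strict shapes ν̄_i ≤ λ̄_{i+1} + g_i, where g_i counts the run of
-- columns [λ♭_{i+1}, ν♭_i − 1); these runs are disjoint and contain no border
-- column, so Σ g_i + #border ≤ λ♭_1 = λ̄_1.
--
-- Lower bound: give the boxes of row i of λ♭ the entry min(i, n), let the last one
-- hold every entry from there up to n, and give all remaining boxes the entry n.
-- Then w occupies the λ♭_w columns of row w and one final column of each row
-- above it inside λ♭, which is λ̄_w columns.

open import Defs
open import Algebra.Properties.CommutativeSemigroup using (interchange)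
open import Data.Bool using (Bool; true; false; T; _∧_; _∨_; if_then_else_)
open import Data.Bool.Properties using (T-∨)
open import Data.Empty using (⊥-elim)
open import Data.Fin using (Fin; toℕ; fromℕ; fromℕ<; inject₁; lower₁)
import Data.Fin as Fin
open import Data.Fin.Properties using (toℕ<n; toℕ-inject₁; toℕ-fromℕ; toℕ-fromℕ<; inject₁-lower₁)
open import Data.Fin.Subset using (Subset; _∈_; Nonempty)
open import Data.Fin.Subset.Properties using (nonempty?)
open import Data.List using (List; []; _∷_; length; applyUpTo)
open import Data.List.Properties using (length-applyUpTo)
import Data.List.Relation.Unary.Linked as Linked
open import Data.Nat
  using (ℕ; zero; suc; _+_; _∸_; _⊓_; _<_; _≤_; _<ᵇ_; z≤n; s≤s; s≤s⁻¹; s<s⁻¹; z<s; _≤?_; _<?_; _≟_)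
open import Data.Nat.Properties
open import Data.Nat.Tactic.RingSolver using (solve-∀)
open import Data.Product using (∃-syntax; _×_; _,_; proj₁; proj₂; map₁)
open import Data.Sum using (_⊎_; inj₁; inj₂)
open import Data.Vec using (lookup; tabulate)
open import Data.Vec.Properties using ([]=⇒lookup; lookup⇒[]=; lookup∘tabulate)
open import Function using (_∘_; _⇔_; mk⇔; Equivalence)
open import Relation.Binary.PropositionalEquality
  using (_≡_; _≢_; refl; sym; trans; cong; cong₂; subst; subst₂)
open import Relation.Nullary using (¬_; Dec; yes; no; contradiction)
open import Relation.Nullary.Decidable using (⌊_⌋; toWitness; fromWitness; _×-dec_; _⊎-dec_; T?)

open Equivalence using (to; from)
open ≤-Reasoning

if-< : ∀ {A : Set} {m n} {x y : A} → m < n → (if m <ᵇ n then x else y) ≡ x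
if-< {m = m} {n} m<n with m <ᵇ n in eq
... | true  = refl
... | false = ⊥-elim (subst T eq (<⇒<ᵇ m<n))

if-≥ : ∀ {A : Set} {m n} {x y : A} → n ≤ m → (if m <ᵇ n then x else y) ≡ y
if-≥ {m = m} {n} n≤m with m <ᵇ n in eq
... | false = refl
... | true  = contradiction (<ᵇ⇒< m n (subst T (sym eq) _)) (≤⇒≯ n≤m)

T-∧-intro : ∀ {x y} → T x → T y → T (x ∧ y)
T-∧-intro {true} _ ty = ty

T-∧-elim : ∀ x {y} → T (x ∧ y) → T x × T y
T-∧-elim true ty = _ , ty

∈⇒T-lookup : ∀ {n} {A : Subset n} {k} → k ∈ A → T (lookup A k)
∈⇒T-lookup k∈A rewrite []=⇒lookup k∈A = _

T-lookup⇒∈ : ∀ {n} {A : Subset n} {k} → T (lookup A k) → k ∈ A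
T-lookup⇒∈ {A = A} {k} h with lookup A k in eq
... | true = lookup⇒[]= k A eq

anyBelow⁺ : ∀ {m} p {i} → i < m → T (p i) → T (anyBelow m p)
anyBelow⁺ {suc m} p i<1+m pᵢ with m<1+n⇒m<n∨m≡n i<1+m
... | inj₁ i<m  = from (T-∨ {anyBelow m p}) (inj₁ (anyBelow⁺ p i<m pᵢ))
... | inj₂ refl = from (T-∨ {anyBelow m p}) (inj₂ pᵢ)

anyBelow⁻ : ∀ {m} p → T (anyBelow m p) → ∃[ i ] i < m × T (p i)
anyBelow⁻ {suc m} p h with to (T-∨ {anyBelow m p}) h
... | inj₁ h′ = let i , i<m , pᵢ = anyBelow⁻ p h′ in i , m<n⇒m<1+n i<m , pᵢ
... | inj₂ pₘ = m , n<1+n m , pₘ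

countBelow-suc-yes : ∀ {N} p → T (p N) → countBelow (suc N) p ≡ suc (countBelow N p)
countBelow-suc-yes {N} p pN with p N
... | true = +-comm (countBelow N p) 1

countBelow-suc-no : ∀ {N} p → ¬ T (p N) → countBelow (suc N) p ≡ countBelow N p
countBelow-suc-no {N} p ¬pN with p N
... | true  = contradiction _ ¬pN
... | false = +-identityʳ (countBelow N p)

countBelow-≤ : ∀ N p → countBelow N p ≤ N
countBelow-≤ zero    p = z≤n
countBelow-≤ (suc N) p with T? (p N)
... | yes pN = ≤-trans (≤-reflexive (countBelow-suc-yes p pN)) (s≤s (countBelow-≤ N p))
... | no ¬pN = ≤-trans (≤-reflexive (countBelow-suc-no p ¬pN)) (m≤n⇒m≤1+n (countBelow-≤ N p))

indicator-mono : ∀ {a b} → (T a → T b) → (if a then 1 else 0) ≤ (if b then 1 else 0)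
indicator-mono {false}        _   = z≤n
indicator-mono {true} {true}  _   = ≤-refl
indicator-mono {true} {false} a⇒b = ⊥-elim (a⇒b _)

countBelow-mono : ∀ N {p q} → (∀ {j} → j < N → T (p j) → T (q j)) →
                  countBelow N p ≤ countBelow N q
countBelow-mono zero    _   = z≤n
countBelow-mono (suc N) p⇒q =
  +-mono-≤ (countBelow-mono N (p⇒q ∘ m<n⇒m<1+n)) (indicator-mono (p⇒q (n<1+n N)))

countBelow-monoˡ : ∀ p {M N} → M ≤ N → countBelow M p ≤ countBelow N p
countBelow-monoˡ p {N = zero}  z≤n = ≤-refl
countBelow-monoˡ p {N = suc N} M≤1+N with m≤n⇒m<n∨m≡n M≤1+N
... | inj₁ M<1+N = ≤-trans (countBelow-monoˡ p (s≤s⁻¹ M<1+N)) (m≤m+n (countBelow N p) _)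
... | inj₂ refl  = ≤-refl

countBelow-all : ∀ N {p} → (∀ {j} → j < N → T (p j)) → countBelow N p ≡ N
countBelow-all zero    _   = refl
countBelow-all (suc N) {p} all =
  trans (countBelow-suc-yes p (all (n<1+n N))) (cong suc (countBelow-all N (all ∘ m<n⇒m<1+n)))

countBelow-support : ∀ {M} N p → (∀ {j} → j < N → T (p j) → j < M) →
                     countBelow N p ≤ countBelow M p
countBelow-support zero    p _     = z≤n
countBelow-support (suc N) p below with T? (p N)
... | yes pN = countBelow-monoˡ p (below (n<1+n N) pN)
... | no ¬pN = ≤-trans (≤-reflexive (countBelow-suc-no p ¬pN))
                       (countBelow-support N p (below ∘ m<n⇒m<1+n))

indicator-∨ : ∀ a b → (T a → ¬ T b) →
              (if a then 1 else 0) + (if b then 1 else 0) ≡ (if a ∨ b then 1 else 0)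
indicator-∨ true  true  disjoint = contradiction _ (disjoint _)
indicator-∨ true  false _        = refl
indicator-∨ false _     _        = refl

countBelow-∨ : ∀ N {p q} → (∀ {j} → j < N → T (p j) → ¬ T (q j)) →
               countBelow N p + countBelow N q ≡ countBelow N (λ j → p j ∨ q j)
countBelow-∨ zero    _ = refl
countBelow-∨ (suc N) {p} {q} disjoint =
  trans (interchange +-commutativeSemigroup (countBelow N p) _ (countBelow N q) _)
        (cong₂ _+_ (countBelow-∨ N (disjoint ∘ m<n⇒m<1+n))
                   (indicator-∨ (p N) (q N) (disjoint (n<1+n N))))

countBelow-interval : ∀ {u} v p → (∀ {j} → u ≤ j → j < v → T (p j)) → v ∸ u ≤ countBelow v p
countBelow-interval {u} zero    p _ = ≤-reflexive (0∸n≡0 u)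
countBelow-interval {u} (suc v) p inside with <-≤-connex v u
... | inj₁ v<u = ≤-trans (≤-reflexive (m≤n⇒m∸n≡0 v<u)) z≤n
... | inj₂ u≤v = begin
  suc v ∸ u             ≡⟨ +-∸-assoc 1 u≤v ⟩
  suc (v ∸ u)           ≤⟨ s≤s (countBelow-interval v p (λ u≤j → inside u≤j ∘ m<n⇒m<1+n)) ⟩
  suc (countBelow v p)  ≡⟨ countBelow-suc-yes p (inside u≤v (n<1+n v)) ⟨
  countBelow (suc v) p  ∎

PrefixClosed : ℕ → (ℕ → Bool) → Set
PrefixClosed N q = ∀ {j} → suc j < N → T (q (suc j)) → T (q j)

prefixClosed-full : ∀ {N q} → PrefixClosed (suc N) q → T (q N) → ∀ {j} → j < suc N → T (q j)
prefixClosed-full {zero}  _  qN (s≤s z≤n) = qN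
prefixClosed-full {suc N} pc qN j<2+N with m<1+n⇒m<n∨m≡n j<2+N
... | inj₁ j<1+N = prefixClosed-full (pc ∘ m<n⇒m<1+n) (pc ≤-refl qN) j<1+N
... | inj₂ refl  = qN

countBelow-prefix⁻ : ∀ N {q} → PrefixClosed N q → ∀ {j} → j < countBelow N q → j < N × T (q j)
countBelow-prefix⁻ (suc N) {q} pc {j} j<c with T? (q N)
... | yes qN = let j<1+N = subst (j <_) (countBelow-all (suc N) (prefixClosed-full pc qN)) j<c
               in j<1+N , prefixClosed-full pc qN j<1+N
... | no ¬qN = map₁ m<n⇒m<1+n
                 (countBelow-prefix⁻ N (pc ∘ m<n⇒m<1+n) (subst (j <_) (countBelow-suc-no q ¬qN) j<c))

countBelow-prefix⁺ : ∀ N {q} → PrefixClosed N q → ∀ {j} → j < N → T (q j) → j < countBelow N q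
countBelow-prefix⁺ (suc N) {q} pc {j} j<1+N qj with T? (q N)
... | yes qN = subst (j <_) (sym (countBelow-all (suc N) (prefixClosed-full pc qN))) j<1+N
... | no ¬qN with m<1+n⇒m<n∨m≡n j<1+N
...   | inj₁ j<N = subst (j <_) (sym (countBelow-suc-no q ¬qN))
                         (countBelow-prefix⁺ N (pc ∘ m<n⇒m<1+n) j<N qj)
...   | inj₂ refl = contradiction qj ¬qN

sumTo : ℕ → (ℕ → ℕ) → ℕ
sumTo zero    f = 0
sumTo (suc n) f = sumTo n f + f n

sumTo-cong : ∀ n {f g} → (∀ i → f i ≡ g i) → sumTo n f ≡ sumTo n g
sumTo-cong zero    _   = refl
sumTo-cong (suc n) f≗g = cong₂ _+_ (sumTo-cong n f≗g) (f≗g n)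

sumTo-mono : ∀ n {f g} → (∀ i → f i ≤ g i) → sumTo n f ≤ sumTo n g
sumTo-mono zero    _   = z≤n
sumTo-mono (suc n) f≤g = +-mono-≤ (sumTo-mono n f≤g) (f≤g n)

sumTo-+ : ∀ n f g → sumTo n (λ i → f i + g i) ≡ sumTo n f + sumTo n g
sumTo-+ zero    f g = refl
sumTo-+ (suc n) f g = trans (cong (_+ (f n + g n)) (sumTo-+ n f g))
                            (interchange +-commutativeSemigroup (sumTo n f) (sumTo n g) (f n) (g n))

sumTo-suc : ∀ n f → sumTo (suc n) f ≡ f 0 + sumTo n (f ∘ suc)
sumTo-suc zero    f = +-comm 0 (f 0)
sumTo-suc (suc n) f = trans (cong (_+ f (suc n)) (sumTo-suc n f)) (+-assoc (f 0) _ _)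

same-increments : ∀ {f g e : ℕ → ℕ} → f 0 ≡ g 0 →
                   (∀ m → f (suc m) ≡ f m + e m) → (∀ m → g (suc m) ≡ g m + e m) →
                   ∀ m → f m ≡ g m
same-increments f₀ _  _  zero    = f₀
same-increments {f} {g} {e} f₀ fₛ gₛ (suc m) =
  trans (fₛ m) (trans (cong (_+ e m) (same-increments {f} {g} {e} f₀ fₛ gₛ m)) (sym (gₛ m)))

sumFin-mono : ∀ n {f g : Fin n → ℕ} → (∀ k → f k ≤ g k) → sumFin n f ≤ sumFin n g
sumFin-mono zero    _   = z≤n
sumFin-mono (suc n) f≤g = +-mono-≤ (f≤g Fin.zero) (sumFin-mono n (f≤g ∘ Fin.suc))

sumFin-init-last : ∀ n (f : Fin (suc n) → ℕ) →
                   sumFin (suc n) f ≡ sumFin n (f ∘ inject₁) + f (fromℕ n)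
sumFin-init-last zero    f = +-comm (f Fin.zero) 0
sumFin-init-last (suc n) f =
  trans (cong (f Fin.zero +_) (sumFin-init-last n (f ∘ Fin.suc))) (sym (+-assoc (f Fin.zero) _ _))

sumFin-toℕ : ∀ n f → sumFin n (f ∘ toℕ) ≡ sumTo n f
sumFin-toℕ zero    f = refl
sumFin-toℕ (suc n) f = trans (cong (f 0 +_) (sumFin-toℕ n (f ∘ suc))) (sym (sumTo-suc n f))

-- Decreasing sequences and the flattening λ♭

Decreasing : (ℕ → ℕ) → Set
Decreasing a = ∀ i → a (suc i) ≤ a i

-- With truncated subtraction: strictly decreasing until the value 0 is reached.
StrictlyDecreasing : (ℕ → ℕ) → Set
StrictlyDecreasing μ = ∀ i → μ (suc i) ≤ μ i ∸ 1

strict⇒decreasing : ∀ {μ} → StrictlyDecreasing μ → Decreasing μ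
strict⇒decreasing μ-strict i = ≤-trans (μ-strict i) (m∸n≤m _ 1)

decreasing⇒antitone : ∀ {a} → Decreasing a → ∀ {i k} → i ≤ k → a k ≤ a i
decreasing⇒antitone dec {k = zero}  z≤n    = ≤-refl
decreasing⇒antitone dec {k = suc k} i≤1+k with m≤n⇒m<n∨m≡n i≤1+k
... | inj₁ i<1+k = ≤-trans (dec k) (decreasing⇒antitone dec (s≤s⁻¹ i<1+k))
... | inj₂ refl  = ≤-refl

PositivePrefix : (ℕ → ℕ) → ℕ → Set
PositivePrefix μ K = ∀ i → (i < K ⇔ 0 < μ i)

positivePrefix-vanish : ∀ {μ K} → PositivePrefix μ K → ∀ {j} → K ≤ j → μ j ≡ 0
positivePrefix-vanish {μ} spec {j} K≤j with μ j in eq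
... | zero  = refl
... | suc _ = contradiction (from (spec j) (subst (0 <_) (sym eq) z<s)) (≤⇒≯ K≤j)

positivePrefix-mono : ∀ {μ ν Kμ Kν} → PositivePrefix μ Kμ → PositivePrefix ν Kν →
                      (∀ i → ν i ≤ μ i) → Kν ≤ Kμ
positivePrefix-mono {Kν = zero}  _      _      _   = z≤n
positivePrefix-mono {Kν = suc k} μ-spec ν-spec ν≤μ =
  from (μ-spec k) (<-≤-trans (to (ν-spec k) (n<1+n k)) (ν≤μ k))

<∸1⇒suc< : ∀ {m n} → m < n ∸ 1 → suc m < n
<∸1⇒suc< {n = suc _} m<n∸1 = s≤s m<n∸1

strict-length≤ : ∀ {μ K} → StrictlyDecreasing μ → PositivePrefix μ K → ∀ {j} → j < K → K ≤ μ j + j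
strict-length≤ {μ} {K} μ-strict spec {j} j<K = begin
  K                      ≡⟨ m+[n∸m]≡n j<K ⟨
  suc j + d              ≡⟨ cong suc (+-comm j d) ⟩
  suc d + j              ≤⟨ +-monoˡ-≤ j (lower d (≤-reflexive (m+[n∸m]≡n j<K))) ⟩
  μ j + j                ∎
  where
  d = K ∸ suc j
  lower : ∀ d {i} → i + d < K → suc d ≤ μ i
  lower zero    {i} i+0<K = to (spec i) (subst (_< K) (+-identityʳ i) i+0<K)
  lower (suc d) {i} i+d<K =
    <∸1⇒suc< (≤-trans (lower d (subst (_< K) (+-suc i d) i+d<K)) (μ-strict i))

flatten : (ℕ → ℕ) → ℕ → ℕ
flatten a zero    = a 0
flatten a (suc i) = (flatten a i ∸ 1) ⊓ a (suc i)

flatten-strict : ∀ a → StrictlyDecreasing (flatten a)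
flatten-strict a i = m⊓n≤m _ _

flatten-≤ : ∀ a i → flatten a i ≤ a i
flatten-≤ a zero    = ≤-refl
flatten-≤ a (suc i) = m⊓n≤n _ _

flatten-mono : ∀ {a b} → (∀ i → b i ≤ a i) → ∀ i → flatten b i ≤ flatten a i
flatten-mono b≤a zero    = b≤a 0
flatten-mono b≤a (suc i) = ⊓-mono-≤ (∸-monoˡ-≤ 1 (flatten-mono b≤a i)) (b≤a (suc i))

flatten-crossing : ∀ {a} → Decreasing a → ∀ {i j} → j < a i → flatten a i ≤ j →
                   ∃[ r ] flatten a r ≡ suc j × flatten a (suc r) ≤ j
flatten-crossing dec {zero} j<a a♭≤j = contradiction a♭≤j (<⇒≱ j<a)
flatten-crossing {a} dec {suc i} {j} j<a a♭≤j with <-≤-connex j (flatten a i)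
... | inj₁ j<a♭ = i , ≤-antisym (≤-trans (m≤n+m∸n _ 1) (s≤s (min-left a♭≤j))) j<a♭ , a♭≤j
  where
  min-left : ∀ {u} → u ⊓ a (suc i) ≤ j → u ≤ j
  min-left {u} h with ⊓-sel u (a (suc i))
  ... | inj₁ u⊓a≡u = subst (_≤ j) u⊓a≡u h
  ... | inj₂ u⊓a≡a = contradiction (subst (_≤ j) u⊓a≡a h) (<⇒≱ j<a)
... | inj₂ a♭≤j′ = flatten-crossing dec (<-≤-trans j<a (dec i)) a♭≤j′

part-flatAux-zero : ∀ prev xs → part (flatAux prev xs) 0 ≡ (prev ∸ 1) ⊓ part xs 0
part-flatAux-zero prev []      = sym (⊓-zeroʳ (prev ∸ 1))
part-flatAux-zero prev (_ ∷ _) = refl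

part-flatAux-suc : ∀ prev xs i →
                   part (flatAux prev xs) (suc i) ≡ (part (flatAux prev xs) i ∸ 1) ⊓ part xs (suc i)
part-flatAux-suc prev []       i       = refl
part-flatAux-suc prev (x ∷ xs) zero    = part-flatAux-zero _ xs
part-flatAux-suc prev (x ∷ xs) (suc i) = part-flatAux-suc _ xs i

part-flat-suc : ∀ l i → part (flat l) (suc i) ≡ (part (flat l) i ∸ 1) ⊓ part l (suc i)
part-flat-suc []       i       = refl
part-flat-suc (x ∷ xs) zero    = part-flatAux-zero x xs
part-flat-suc (x ∷ xs) (suc i) = part-flatAux-suc x xs i

part-flat : ∀ l i → part (flat l) i ≡ flatten (part l) i
part-flat []      zero    = refl
part-flat (_ ∷ _) zero    = refl
part-flat l       (suc i) =
  trans (part-flat-suc l i) (cong (λ x → (x ∸ 1) ⊓ part l (suc i)) (part-flat l i))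

numPos-zeros : ∀ xs → (∀ i → part xs i ≡ 0) → numPos xs ≡ 0
numPos-zeros []           _     = refl
numPos-zeros (zero  ∷ xs) zeros = numPos-zeros xs (zeros ∘ suc)
numPos-zeros (suc _ ∷ xs) zeros = contradiction (zeros 0) λ ()

numPos-strict : ∀ xs → StrictlyDecreasing (part xs) → PositivePrefix (part xs) (numPos xs)
numPos-strict []           _      i       = mk⇔ (λ ()) (λ ())
numPos-strict (zero  ∷ xs) xs-strict i =
  mk⇔ (λ i<K → contradiction (subst (i <_) (numPos-zeros xs (zeros ∘ suc)) i<K) λ ())
      (λ 0<x → ⊥-elim (<-irrefl (sym (zeros i)) 0<x))
  where
  zeros : ∀ k → part (zero ∷ xs) k ≡ 0
  zeros k = n≤0⇒n≡0
    (decreasing⇒antitone (strict⇒decreasing {part (zero ∷ xs)} xs-strict) {0} {k} z≤n)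
numPos-strict (suc _ ∷ _)  _      zero    = mk⇔ (λ _ → z<s) (λ _ → z<s)
numPos-strict (suc _ ∷ xs) xs-strict (suc i) =
  mk⇔ (to spec ∘ s<s⁻¹) (s≤s ∘ from spec)
  where spec = numPos-strict xs (xs-strict ∘ suc) i

numPos-flat : ∀ l → PositivePrefix (flatten (part l)) (numPos (flat l))
numPos-flat l i = subst (λ x → i < numPos (flat l) ⇔ 0 < x) (part-flat l i)
  (numPos-strict (flat l) (λ k → ≤-trans (≤-reflexive (part-flat-suc l k)) (m⊓n≤m _ _)) i)

-- With 0-indexed rows as in `barSize`, λ̄_i is λ♭_i + i for i < K and K otherwise;
-- as λ♭_i = 0 for i ≥ K, this is λ♭_i + min(i, K).
barPart : (ℕ → ℕ) → ℕ → ℕ → ℕ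
barPart μ K i = μ i + i ⊓ K

barPart-zero : ∀ μ K → barPart μ K 0 ≡ μ 0
barPart-zero μ K = +-identityʳ (μ 0)

barPart-if : ∀ {μ K} → PositivePrefix μ K → ∀ i → (if i <ᵇ K then μ i + i else K) ≡ barPart μ K i
barPart-if {μ} {K} spec i with <-≤-connex i K
... | inj₁ i<K = trans (if-< i<K) (cong (μ i +_) (sym (m≤n⇒m⊓n≡m (<⇒≤ i<K))))
... | inj₂ K≤i = trans (if-≥ K≤i)
                       (sym (cong₂ _+_ (positivePrefix-vanish spec K≤i) (m≥n⇒m⊓n≡n K≤i)))

length≤barPart : ∀ {μ K} → StrictlyDecreasing μ → PositivePrefix μ K → ∀ j → K ≤ barPart μ K j
length≤barPart {μ} {K} μ-strict spec j with <-≤-connex j K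
... | inj₁ j<K =
  subst (λ x → K ≤ μ j + x) (sym (m≤n⇒m⊓n≡m (<⇒≤ j<K))) (strict-length≤ μ-strict spec j<K)
... | inj₂ K≤j = subst (λ x → K ≤ μ j + x) (sym (m≥n⇒m⊓n≡n K≤j)) (m≤n+m _ _)

-- `barSize n l` unfolds to a local recursion that also carries `n`.  Abstracting the two
-- copies of `n` separately lets unification name that recursion in the type of
-- `barSize-unfolded`, where it is identified with the sum by its recurrence.
mutual
  barSize≡sumTo : ∀ n l →
    barSize n l ≡
    sumTo n (λ i → if i <ᵇ numPos (flat l) then part (flat l) i + i else numPos (flat l))
  barSize≡sumTo zero    l = refl
  barSize≡sumTo (suc m) l with suc m | m
  ... | X | M = barSize-unfolded l X M

  barSize-unfolded : (l : List ℕ) (X M : ℕ) → _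
  barSize-unfolded l X = same-increments refl (λ _ → refl) (λ _ → refl)

barSize≡sum-barPart : ∀ n l → barSize n l ≡ sumTo n (barPart (flatten (part l)) (numPos (flat l)))
barSize≡sum-barPart n l = trans (barSize≡sumTo n l) (sumTo-cong n λ i →
  trans (cong (λ x → if i <ᵇ numPos (flat l) then x + i else numPos (flat l)) (part-flat l i))
        (barPart-if (numPos-flat l) i))

-- Border columns

-- Box (i, j) lies in a/b, or is a removable corner of b.
BorderBox : (a b : ℕ → ℕ) → ℕ → ℕ → Set
BorderBox a b i j = (j < a i × b i ≤ j) ⊎ (b i ≡ suc j × b (suc i) ≤ j)

borderBox? : ∀ a b i j → Dec (BorderBox a b i j)
borderBox? a b i j = ((j <? a i) ×-dec (b i ≤? j)) ⊎-dec ((b i ≟ suc j) ×-dec (b (suc i) ≤? j))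

border : ℕ → (a b : ℕ → ℕ) → ℕ → Bool
border L a b j = anyBelow L (λ i → ⌊ borderBox? a b i j ⌋)

border⁺ : ∀ {L a b i j} → i < L → BorderBox a b i j → T (border L a b j)
border⁺ {a = a} {b} {i} {j} i<L box =
  anyBelow⁺ (λ i → ⌊ borderBox? a b i j ⌋) i<L (fromWitness {a? = borderBox? a b i j} box)

border⁻ : ∀ {L a b j} → T (border L a b j) → ∃[ i ] i < L × BorderBox a b i j
border⁻ {a = a} {b} {j} h =
  let i , i<L , box = anyBelow⁻ (λ i → ⌊ borderBox? a b i j ⌋) h
  in  i , i<L , toWitness {a? = borderBox? a b i j} box

module _ {L} {a b : ℕ → ℕ} (a-dec : Decreasing a) (b≤a : ∀ i → b i ≤ a i)
         (a-support : ∀ {r} → 0 < a r → r < L) where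

  private
    a♭ = flatten a
    b♭ = flatten b

    crossing-border : ∀ {r j} → a♭ r ≡ suc j → a♭ (suc r) ≤ j → BorderBox a♭ b♭ r j
    crossing-border {r} {j} a♭r≡1+j a♭r+1≤j with <-≤-connex j (b♭ r)
    ... | inj₁ j<b♭r = inj₂ (≤-antisym (≤-trans (flatten-mono b≤a r) (≤-reflexive a♭r≡1+j)) j<b♭r ,
                             ≤-trans (flatten-mono b≤a (suc r)) a♭r+1≤j)
    ... | inj₂ b♭r≤j = inj₁ (≤-reflexive (sym a♭r≡1+j) , b♭r≤j)

    outside-flatten : ∀ {i j} → j < a i → b♭ i ≤ j → ∃[ r ] r < L × BorderBox a♭ b♭ r j
    outside-flatten {i} {j} j<a b♭≤j with <-≤-connex j (a♭ i)
    ... | inj₁ j<a♭ = i , a-support (m<n⇒0<n j<a) , inj₁ (j<a♭ , b♭≤j)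
    ... | inj₂ a♭≤j =
      let r , a♭r≡1+j , a♭r+1≤j = flatten-crossing a-dec j<a a♭≤j
      in  r , a-support (<-≤-trans (subst (0 <_) (sym a♭r≡1+j) z<s) (flatten-≤ a r)) ,
          crossing-border a♭r≡1+j a♭r+1≤j

    borderBox-flatten : ∀ {i j} → i < L → BorderBox a b i j → ∃[ r ] r < L × BorderBox a♭ b♭ r j
    borderBox-flatten {i} _ (inj₁ (j<a , b≤j)) = outside-flatten j<a (≤-trans (flatten-≤ b i) b≤j)
    borderBox-flatten {i} {j} i<L (inj₂ (b≡1+j , b′≤j)) with <-≤-connex j (b♭ i)
    ... | inj₁ j<b♭ = i , i<L , inj₂ (≤-antisym (≤-trans (flatten-≤ b i) (≤-reflexive b≡1+j)) j<b♭ ,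
                                      ≤-trans (flatten-≤ b (suc i)) b′≤j)
    ... | inj₂ b♭≤j = outside-flatten (<-≤-trans (≤-reflexive (sym b≡1+j)) (b≤a i)) b♭≤j

  border-flatten : ∀ {j} → T (border L a b j) → T (border L a♭ b♭ j)
  border-flatten h =
    let i , i<L , box = border⁻ h
        r , r<L , box♭ = borderBox-flatten i<L box
    in  border⁺ r<L box♭

-- The inequality for strict shapes

GapBox : (μ ν : ℕ → ℕ) → ℕ → ℕ → Set
GapBox μ ν i j = μ (suc i) ≤ j × j < ν i ∸ 1

gapBox? : ∀ μ ν i j → Dec (GapBox μ ν i j)
gapBox? μ ν i j = (μ (suc i) ≤? j) ×-dec (j <? ν i ∸ 1)

gaps : ℕ → (μ ν : ℕ → ℕ) → ℕ → Bool
gaps M μ ν j = anyBelow M (λ i → ⌊ gapBox? μ ν i j ⌋)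

module StrictShapes {μ ν : ℕ → ℕ} {Kμ Kν : ℕ}
                    (μ-strict : StrictlyDecreasing μ) (ν-strict : StrictlyDecreasing ν)
                    (ν≤μ : ∀ i → ν i ≤ μ i)
                    (μ-spec : PositivePrefix μ Kμ) (ν-spec : PositivePrefix ν Kν) where

  private
    μ-antitone : ∀ {i k} → i ≤ k → μ k ≤ μ i
    μ-antitone = decreasing⇒antitone (strict⇒decreasing μ-strict)

    ν-antitone : ∀ {i k} → i ≤ k → ν k ≤ ν i
    ν-antitone = decreasing⇒antitone (strict⇒decreasing ν-strict)

    ν≤μ₀ : ∀ i → ν i ∸ 1 ≤ μ 0
    ν≤μ₀ i = ≤-trans (m∸n≤m _ 1) (≤-trans (ν≤μ i) (μ-antitone z≤n))

  gapLength : ℕ → ℕ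
  gapLength i = (ν i ∸ 1) ∸ μ (suc i)

  barPart-step : ∀ i → barPart ν Kν i ≤ barPart μ Kμ (suc i) + gapLength i
  barPart-step i with <-≤-connex i Kν
  ... | inj₁ i<Kν = begin
    ν i + i ⊓ Kν                       ≡⟨ cong (ν i +_) (m≤n⇒m⊓n≡m (<⇒≤ i<Kν)) ⟩
    ν i + i                            ≤⟨ +-monoˡ-≤ i ν≤1+μ+gap ⟩
    suc (μ (suc i) + gapLength i) + i  ≡⟨ rearrange (μ (suc i)) (gapLength i) i ⟩
    μ (suc i) + suc i + gapLength i    ≡⟨ cong (λ x → μ (suc i) + x + gapLength i) 1+i⊓Kμ ⟨
    barPart μ Kμ (suc i) + gapLength i ∎
    where
    ν≤1+μ+gap = ≤-trans (m≤n+m∸n (ν i) 1) (s≤s (m≤n+m∸n _ (μ (suc i))))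
    1+i⊓Kμ = m≤n⇒m⊓n≡m (≤-trans i<Kν (positivePrefix-mono μ-spec ν-spec ν≤μ))
    rearrange : ∀ a g i → suc (a + g) + i ≡ a + suc i + g
    rearrange = solve-∀
  ... | inj₂ Kν≤i = begin
    ν i + i ⊓ Kν                       ≡⟨ cong₂ _+_ (positivePrefix-vanish ν-spec Kν≤i)
                                                    (m≥n⇒m⊓n≡n Kν≤i) ⟩
    Kν                                 ≤⟨ positivePrefix-mono μ-spec ν-spec ν≤μ ⟩
    Kμ                                 ≤⟨ length≤barPart μ-strict μ-spec (suc i) ⟩
    barPart μ Kμ (suc i)               ≤⟨ m≤m+n _ _ ⟩
    barPart μ Kμ (suc i) + gapLength i ∎

  gapLength≤ : ∀ M → sumTo M gapLength ≤ countBelow (μ 0) (gaps M μ ν)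
  gapLength≤ zero    = z≤n
  gapLength≤ (suc M) = begin
    sumTo M gapLength + gapLength M
      ≤⟨ +-mono-≤ (gapLength≤ M) (≤-trans (countBelow-interval (ν M ∸ 1) gapRow inside)
                                          (countBelow-monoˡ gapRow (ν≤μ₀ M))) ⟩
    countBelow (μ 0) (gaps M μ ν) + countBelow (μ 0) gapRow
      ≡⟨ countBelow-∨ (μ 0) (λ _ → disjoint) ⟩
    countBelow (μ 0) (gaps (suc M) μ ν) ∎
    where
    gapRow : ℕ → Bool
    gapRow j = ⌊ gapBox? μ ν M j ⌋
    inside : ∀ {j} → μ (suc M) ≤ j → j < ν M ∸ 1 → T (gapRow j)
    inside μ≤j j<ν = fromWitness {a? = gapBox? μ ν M _} (μ≤j , j<ν)
    disjoint : ∀ {j} → T (gaps M μ ν j) → ¬ T (gapRow j)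
    disjoint {j} h h′ =
      let i , i<M , box = anyBelow⁻ (λ i → ⌊ gapBox? μ ν i j ⌋) h
          μ≤j , _ = toWitness {a? = gapBox? μ ν i j} box
          _ , j<ν = toWitness {a? = gapBox? μ ν M j} h′
      in  <⇒≱ j<ν (≤-trans (m∸n≤m _ 1) (≤-trans (ν≤μ M) (≤-trans (μ-antitone i<M) μ≤j)))

  border-gap-disjoint : ∀ {i i′ j} → BorderBox μ ν i j → ¬ GapBox μ ν i′ j
  border-gap-disjoint {i} {i′} (inj₁ (j<μ , ν≤j)) (μ′≤j , j<ν′) with <-≤-connex i′ i
  ... | inj₁ i′<i = <⇒≱ j<μ (≤-trans (μ-antitone i′<i) μ′≤j)
  ... | inj₂ i≤i′ = <⇒≱ (≤-trans j<ν′ (m∸n≤m _ 1)) (≤-trans (ν-antitone i≤i′) ν≤j)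
  border-gap-disjoint {i} {i′} (inj₂ (ν≡1+j , _)) (μ′≤j , j<ν′) with <-≤-connex i′ i
  ... | inj₁ i′<i = <⇒≱ (≤-reflexive (sym ν≡1+j))
                        (≤-trans (ν≤μ i) (≤-trans (μ-antitone i′<i) μ′≤j))
  ... | inj₂ i≤i′ = <⇒≱ j<ν′ (∸-monoˡ-≤ 1 (≤-trans (ν-antitone i≤i′) (≤-reflexive ν≡1+j)))

  gaps-border≤ : ∀ {L} M → countBelow (μ 0) (gaps M μ ν) + countBelow (μ 0) (border L μ ν) ≤ μ 0
  gaps-border≤ {L} M =
    ≤-trans (≤-reflexive (countBelow-∨ (μ 0) (λ _ → disjoint))) (countBelow-≤ (μ 0) _)
    where
    disjoint : ∀ {j} → T (gaps M μ ν j) → ¬ T (border L μ ν j)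
    disjoint {j} g b =
      let i′ , _ , gap = anyBelow⁻ {M} (λ i → ⌊ gapBox? μ ν i j ⌋) g
          _ , _ , box = border⁻ {L} {μ} {ν} b
      in  border-gap-disjoint box (toWitness {a? = gapBox? μ ν i′ j} gap)

  sum-barPart-border : ∀ {L} n →
    sumTo n (barPart ν Kν) + countBelow (μ 0) (border L μ ν) ≤ sumTo (suc n) (barPart μ Kμ)
  sum-barPart-border {L} n = begin
    sumTo n (barPart ν Kν) + C
      ≤⟨ +-monoˡ-≤ C (sumTo-mono n barPart-step) ⟩
    sumTo n (λ i → barPart μ Kμ (suc i) + gapLength i) + C
      ≡⟨ cong (_+ C) (sumTo-+ n (barPart μ Kμ ∘ suc) gapLength) ⟩
    B + sumTo n gapLength + C
      ≤⟨ +-monoˡ-≤ C (+-monoʳ-≤ B (gapLength≤ n)) ⟩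
    B + G + C
      ≡⟨ +-assoc B G C ⟩
    B + (G + C)
      ≤⟨ +-monoʳ-≤ B (gaps-border≤ {L} n) ⟩
    B + μ 0
      ≡⟨ +-comm B (μ 0) ⟩
    μ 0 + B
      ≡⟨ cong (_+ B) (barPart-zero μ Kμ) ⟨
    barPart μ Kμ 0 + B
      ≡⟨ sumTo-suc n (barPart μ Kμ) ⟨
    sumTo (suc n) (barPart μ Kμ) ∎
    where
    B = sumTo n (barPart μ Kμ ∘ suc)
    G = countBelow (μ 0) (gaps n μ ν)
    C = countBelow (μ 0) (border L μ ν)

part-support : ∀ l {i} → 0 < part l i → i < length l
part-support (_ ∷ _)  {zero}  _ = z<s
part-support (_ ∷ xs) {suc i} h = s≤s (part-support xs h)

part-beyond : ∀ l {i} → length l ≤ i → part l i ≡ 0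
part-beyond []                 _       = refl
part-beyond (_ ∷ xs) {suc i} (s≤s h) = part-beyond xs h

barSize-border : ∀ n l ν → Decreasing (part l) → (∀ i → part ν i ≤ part l i) →
  barSize n ν + countBelow (part l 0) (border (length l) (part l) (part ν)) ≤ barSize (suc n) l
barSize-border n l ν l-dec ν≤l = begin
  barSize n ν + countBelow (part l 0) (border L (part l) (part ν))
    ≤⟨ +-mono-≤ (≤-reflexive (barSize≡sum-barPart n ν))
                (countBelow-mono (part l 0) (λ _ → border-flatten l-dec ν≤l (part-support l))) ⟩
  sumTo n (barPart ν♭ (numPos (flat ν))) + countBelow (part l 0) (border L l♭ ν♭)
    ≤⟨ StrictShapes.sum-barPart-border (flatten-strict _) (flatten-strict _) (flatten-mono ν≤l)
                                       (numPos-flat l) (numPos-flat ν) {L} n ⟩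
  sumTo (suc n) (barPart l♭ (numPos (flat l)))
    ≡⟨ barSize≡sum-barPart (suc n) l ⟨
  barSize (suc n) l ∎
  where
  L = length l
  l♭ = flatten (part l)
  ν♭ = flatten (part ν)

-- Upper bound

restrict : ∀ {n} → Subset (suc n) → Subset n
restrict A = tabulate (λ k → lookup A (inject₁ k))

∈-restrict⁻ : ∀ {n} {A : Subset (suc n)} {k} → k ∈ restrict A → inject₁ k ∈ A
∈-restrict⁻ {A = A} {k} h = T-lookup⇒∈ (subst T (lookup∘tabulate _ k) (∈⇒T-lookup h))

∈-restrict⁺ : ∀ {n} {A : Subset (suc n)} {k} → inject₁ k ∈ A → k ∈ restrict A
∈-restrict⁺ {A = A} {k} h = T-lookup⇒∈ (subst T (sym (lookup∘tabulate _ k)) (∈⇒T-lookup h))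

restrict-≤ₛ : ∀ {n} {A B : Subset (suc n)} → A ≤ₛ B → restrict A ≤ₛ restrict B
restrict-≤ₛ A≤B x y x∈ y∈ =
  subst₂ _≤_ (toℕ-inject₁ x) (toℕ-inject₁ y) (A≤B _ _ (∈-restrict⁻ x∈) (∈-restrict⁻ y∈))

toℕ-inject₁<n : ∀ {n} (k : Fin n) → toℕ (inject₁ k) < n
toℕ-inject₁<n k = subst (_< _) (sym (toℕ-inject₁ k)) (toℕ<n k)

restrict-nonempty : ∀ {n} {A B : Subset (suc n)} → A ≤ₛ B → Nonempty A →
                    Nonempty (restrict B) → Nonempty (restrict A)
restrict-nonempty {n} {A} A≤B (y , y∈A) (k , k∈B) =
  lower₁ y n≢y , ∈-restrict⁺ (subst (_∈ A) (sym (inject₁-lower₁ y n≢y)) y∈A)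
  where
  n≢y : n ≢ toℕ y
  n≢y n≡y = <⇒≱ (toℕ-inject₁<n k)
                (subst (_≤ toℕ (inject₁ k)) (sym n≡y) (A≤B _ _ y∈A (∈-restrict⁻ k∈B)))

restrict-empty-above-top : ∀ {n} {A B : Subset (suc n)} → A ≤ₛ B → fromℕ n ∈ A →
                           ¬ Nonempty (restrict B)
restrict-empty-above-top {n} A≤B top∈A (k , k∈B) =
  <⇒≱ (toℕ-inject₁<n k) (subst (_≤ toℕ (inject₁ k)) (toℕ-fromℕ n) (A≤B _ _ top∈A (∈-restrict⁻ k∈B)))

hasNonTop : ∀ {n} → Subset (suc n) → Bool
hasNonTop A = ⌊ nonempty? (restrict A) ⌋

hasNonTop-antitone : ∀ {n} {A B : Subset (suc n)} → A ≤ₛ B → Nonempty A →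
                     T (hasNonTop B) → T (hasNonTop A)
hasNonTop-antitone {A = A} {B} A≤B A≢∅ h = fromWitness {a? = nonempty? (restrict A)}
  (restrict-nonempty A≤B A≢∅ (toWitness {a? = nonempty? (restrict B)} h))

colContains⁺ : ∀ {n} l (φ : Filling n) {k i j} → i < length l → j < part l i → k ∈ φ i j →
               T (colContains l φ k j)
colContains⁺ l φ {k} {j = j} i<L j<a k∈ =
  anyBelow⁺ (λ i → (j <ᵇ part l i) ∧ lookup (φ i j) k) i<L (T-∧-intro (<⇒<ᵇ j<a) (∈⇒T-lookup k∈))

colContains⁻ : ∀ {n} l (φ : Filling n) {k j} → T (colContains l φ k j) →
               ∃[ i ] i < length l × j < part l i × k ∈ φ i j
colContains⁻ l φ {k} {j} h =
  let i , i<L , box = anyBelow⁻ (λ i → (j <ᵇ part l i) ∧ lookup (φ i j) k) h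
      j<a , k∈ = T-∧-elim (j <ᵇ part l i) box
  in  i , i<L , <ᵇ⇒< j (part l i) j<a , T-lookup⇒∈ k∈

part-applyUpTo : ∀ f L → (∀ {i} → L ≤ i → f i ≡ 0) → ∀ i → part (applyUpTo f L) i ≡ f i
part-applyUpTo f zero    vanish i       = sym (vanish z≤n)
part-applyUpTo f (suc L) vanish zero    = refl
part-applyUpTo f (suc L) vanish (suc i) = part-applyUpTo (f ∘ suc) L (vanish ∘ s≤s) i

≤-by-< : ∀ {m n} → (∀ {k} → k < m → k < n) → m ≤ n
≤-by-< {zero}  _     = z≤n
≤-by-< {suc m} below = below (n<1+n m)

-- ν is the shape formed by the boxes of φ that hold an entry other than the top one.
module SmallEntries {n} (l : List ℕ) (φ : Filling (suc n)) (l-dec : Decreasing (part l))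
                    (φ-svrpp : IsSVRPP (suc n) l φ) where

  private
    a = part l
    L = length l
    nonempty = proj₁ φ-svrpp
    row-≤ = proj₁ (proj₂ φ-svrpp)
    col-≤ = proj₂ (proj₂ φ-svrpp)

    small : ℕ → ℕ → Bool
    small i j = hasNonTop (φ i j)

    small-prefixClosed : ∀ i → PrefixClosed (a i) (small i)
    small-prefixClosed i {j} 1+j<a =
      hasNonTop-antitone (row-≤ i j 1+j<a) (nonempty i j (<-trans (n<1+n j) 1+j<a))

    smallLength : ℕ → ℕ
    smallLength i = countBelow (a i) (small i)

  ν : List ℕ
  ν = applyUpTo smallLength L

  φ′ : Filling n
  φ′ i j = restrict (φ i j)

  private
    part-ν : ∀ i → part ν i ≡ smallLength i
    part-ν = part-applyUpTo smallLength L λ {i} L≤i →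
      cong (λ m → countBelow m (small i)) (part-beyond l L≤i)

    ∈ν⁻ : ∀ {i j} → j < part ν i → j < a i × T (small i j)
    ∈ν⁻ {i} {j} h = countBelow-prefix⁻ (a i) (small-prefixClosed i) (subst (j <_) (part-ν i) h)

    ∈ν⁺ : ∀ {i j} → j < a i → T (small i j) → j < part ν i
    ∈ν⁺ {i} {j} j<a s =
      subst (j <_) (sym (part-ν i)) (countBelow-prefix⁺ (a i) (small-prefixClosed i) j<a s)

  ν-dec : Decreasing (part ν)
  ν-dec i = ≤-by-< λ {j} h →
    let j<a , s = ∈ν⁻ h
        j<a′ = <-≤-trans j<a (l-dec i)
    in  ∈ν⁺ j<a′ (hasNonTop-antitone (col-≤ i j j<a) (nonempty i j j<a′) s)

  ν≤l : ∀ i → part ν i ≤ a i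
  ν≤l i = subst (_≤ a i) (sym (part-ν i)) (countBelow-≤ (a i) (small i))

  φ′-svrpp : IsSVRPP n ν φ′
  φ′-svrpp = (λ i j h → toWitness {a? = nonempty? (φ′ i j)} (proj₂ (∈ν⁻ h)))
           , (λ i j h → restrict-≤ₛ (row-≤ i j (proj₁ (∈ν⁻ h))))
           , (λ i j h → restrict-≤ₛ (col-≤ i j (proj₁ (∈ν⁻ h))))

  ircont-restrict : ∀ k → ircont l φ (inject₁ k) ≤ ircont ν φ′ k
  ircont-restrict k =
    ≤-trans (countBelow-mono (a 0) (λ _ → into)) (countBelow-support (a 0) _ (λ _ → below))
    where
    into : ∀ {j} → T (colContains l φ (inject₁ k) j) → T (colContains ν φ′ k j)
    into h =
      let i , i<L , j<a , k∈ = colContains⁻ l φ h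
      in  colContains⁺ ν φ′ (subst (i <_) (sym (length-applyUpTo smallLength L)) i<L)
                       (∈ν⁺ j<a (fromWitness {a? = nonempty? (φ′ i _)} (k , ∈-restrict⁺ k∈)))
                       (∈-restrict⁺ k∈)
    below : ∀ {j} → T (colContains ν φ′ k j) → j < part ν 0
    below h = let _ , _ , j<ν , _ = colContains⁻ ν φ′ h
              in  <-≤-trans j<ν (decreasing⇒antitone ν-dec z≤n)

  private
    top-border : ∀ {i j} → j < a i → fromℕ n ∈ φ i j → BorderBox a (part ν) i j
    top-border {i} {j} j<a top∈ with <-≤-connex j (part ν i)
    ... | inj₂ ν≤j = inj₁ (j<a , ν≤j)
    ... | inj₁ j<ν = inj₂ (≤-antisym ν≤1+j j<ν , ν′≤j)
      where
      ν≤1+j : part ν i ≤ suc j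
      ν≤1+j = ≮⇒≥ λ 1+j<ν → let 1+j<a , s = ∈ν⁻ 1+j<ν in
        restrict-empty-above-top (row-≤ i j 1+j<a) top∈ (toWitness {a? = nonempty? (φ′ i (suc j))} s)
      ν′≤j : part ν (suc i) ≤ j
      ν′≤j = ≮⇒≥ λ j<ν′ → let j<a′ , s = ∈ν⁻ j<ν′ in
        restrict-empty-above-top (col-≤ i j j<a′) top∈ (toWitness {a? = nonempty? (φ′ (suc i) j)} s)

  ircont-top : ircont l φ (fromℕ n) ≤ countBelow (a 0) (border L a (part ν))
  ircont-top = countBelow-mono (a 0) λ _ h →
    let i , i<L , j<a , top∈ = colContains⁻ l φ h in border⁺ i<L (top-border j<a top∈)

ircontSize≤barSize : ∀ n l φ → Decreasing (part l) → IsSVRPP n l φ → ircontSize n l φ ≤ barSize n l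
ircontSize≤barSize zero    l φ _     _       = z≤n
ircontSize≤barSize (suc n) l φ l-dec φ-svrpp = begin
  ircontSize (suc n) l φ
    ≡⟨ sumFin-init-last n (ircont l φ) ⟩
  sumFin n (ircont l φ ∘ inject₁) + ircont l φ (fromℕ n)
    ≤⟨ +-mono-≤ (sumFin-mono n ircont-restrict) ircont-top ⟩
  ircontSize n ν φ′ + countBelow (part l 0) (border (length l) (part l) (part ν))
    ≤⟨ +-monoˡ-≤ _ (ircontSize≤barSize n ν φ′ ν-dec φ′-svrpp) ⟩
  barSize n ν + countBelow (part l 0) (border (length l) (part l) (part ν))
    ≤⟨ barSize-border n l ν l-dec ν≤l ⟩
  barSize (suc n) l ∎
  where open SmallEntries l φ l-dec φ-svrpp

-- Lower bound

interval : ∀ N → ℕ → ℕ → Subset N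
interval N lo hi = tabulate (λ v → ⌊ (lo ≤? toℕ v) ×-dec (toℕ v ≤? hi) ⌋)

∈interval⁻ : ∀ {N lo hi v} → v ∈ interval N lo hi → lo ≤ toℕ v × toℕ v ≤ hi
∈interval⁻ {N} {lo} {hi} {v} h = toWitness {a? = (lo ≤? toℕ v) ×-dec (toℕ v ≤? hi)}
  (subst T (lookup∘tabulate _ v) (∈⇒T-lookup h))

∈interval⁺ : ∀ {N lo hi v} → lo ≤ toℕ v → toℕ v ≤ hi → v ∈ interval N lo hi
∈interval⁺ {N} {lo} {hi} {v} lo≤v v≤hi = T-lookup⇒∈ (subst T (sym (lookup∘tabulate _ v))
  (fromWitness {a? = (lo ≤? toℕ v) ×-dec (toℕ v ≤? hi)} (lo≤v , v≤hi)))

interval-≤ₛ : ∀ {N lo₁ hi₁ lo₂ hi₂} → hi₁ ≤ lo₂ → interval N lo₁ hi₁ ≤ₛ interval N lo₂ hi₂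
interval-≤ₛ hi≤lo x y x∈ y∈ =
  ≤-trans (proj₂ (∈interval⁻ x∈)) (≤-trans hi≤lo (proj₁ (∈interval⁻ y∈)))

module FlatFilling (n : ℕ) (l : List ℕ) where

  private
    μ = flatten (part l)
    K = numPos (flat l)

    μ-antitone : ∀ {i k} → i ≤ k → μ k ≤ μ i
    μ-antitone = decreasing⇒antitone (strict⇒decreasing (flatten-strict (part l)))

  entry : ℕ → ℕ → ℕ
  entry i j = if j <ᵇ μ i then i ⊓ n else n

  -- Adjacent boxes of a row share their boundary entry, which makes rows weakly increase.
  filling : Filling (suc n)
  filling i j = interval (suc n) (entry i j) (entry i (suc j))

  private
    entry-≤ : ∀ i j → entry i j ≤ n
    entry-≤ i j with <-≤-connex j (μ i)
    ... | inj₁ j<μ = ≤-trans (≤-reflexive (if-< j<μ)) (m⊓n≤n i n)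
    ... | inj₂ μ≤j = ≤-reflexive (if-≥ μ≤j)

    ⊓≤entry : ∀ {i i′} j → i ≤ i′ → i ⊓ n ≤ entry i′ j
    ⊓≤entry {i} {i′} j i≤i′ with <-≤-connex j (μ i′)
    ... | inj₁ j<μ = ≤-trans (⊓-monoˡ-≤ n i≤i′) (≤-reflexive (sym (if-< j<μ)))
    ... | inj₂ μ≤j = ≤-trans (m⊓n≤n i n) (≤-reflexive (sym (if-≥ μ≤j)))

    entry-row : ∀ i j → entry i j ≤ entry i (suc j)
    entry-row i j with <-≤-connex j (μ i)
    ... | inj₁ j<μ = ≤-trans (≤-reflexive (if-< j<μ)) (⊓≤entry (suc j) ≤-refl)
    ... | inj₂ μ≤j = ≤-trans (≤-reflexive (if-≥ μ≤j)) (≤-reflexive (sym (if-≥ (m≤n⇒m≤1+n μ≤j))))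

    entry-col : ∀ i j → entry i (suc j) ≤ entry (suc i) j
    entry-col i j with <-≤-connex (suc j) (μ i)
    ... | inj₁ 1+j<μ = ≤-trans (≤-reflexive (if-< 1+j<μ)) (⊓≤entry j (n≤1+n i))
    ... | inj₂ μ≤1+j = ≤-reflexive (trans (if-≥ μ≤1+j)
                         (sym (if-≥ (≤-trans (flatten-strict (part l) i) (∸-monoˡ-≤ 1 μ≤1+j)))))

  filling-svrpp : IsSVRPP (suc n) l filling
  filling-svrpp =
      (λ i j _ → fromℕ< (s≤s (entry-≤ i j)) ,
                 ∈interval⁺ (≤-reflexive (sym (toℕ-fromℕ< _)))
                            (≤-trans (≤-reflexive (toℕ-fromℕ< _)) (entry-row i j)))
    , (λ _ _ _ → interval-≤ₛ ≤-refl)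
    , (λ i j _ → interval-≤ₛ (entry-col i j))

  private
    column-contains : ∀ {v i j} → j < μ i → entry i j ≤ toℕ v → toℕ v ≤ entry i (suc j) →
                      T (colContains l filling v j)
    column-contains {i = i} j<μ lo≤v v≤hi =
      colContains⁺ l filling (part-support l (m<n⇒0<n j<a)) j<a (∈interval⁺ lo≤v v≤hi)
      where j<a = <-≤-trans j<μ (flatten-≤ (part l) i)

  module _ (v : Fin (suc n)) where

    private
      w = toℕ v
      w≤n = s≤s⁻¹ (toℕ<n v)
      m = w ⊓ K
      C = colContains l filling v

      row-w : ∀ {j} → j < μ w → T (C j)
      row-w {j} j<μ = column-contains {v} {w} j<μ (≤-trans (≤-reflexive (if-< j<μ)) (m⊓n≤m w n))
        (≤-trans (≤-reflexive (sym (m≤n⇒m⊓n≡m w≤n))) (⊓≤entry (suc j) ≤-refl))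

      μ-positive : ∀ {r} → r < m → 0 < μ r
      μ-positive {r} r<m = to (numPos-flat l r) (<-≤-trans r<m (m⊓n≤n w K))

      last-column : ∀ {r} → r < m → T (C (μ r ∸ 1))
      last-column {r} r<m = column-contains {v} {r} last<μ
        (≤-trans (≤-reflexive (if-< last<μ)) (≤-trans (m⊓n≤m r n) (<⇒≤ (<-≤-trans r<m (m⊓n≤m w K)))))
        (≤-trans w≤n (≤-reflexive (sym (if-≥ (≤-reflexive (sym 1+last≡μ))))))
        where
        1+last≡μ : suc (μ r ∸ 1) ≡ μ r
        1+last≡μ = m+[n∸m]≡n (μ-positive r<m)
        last<μ : μ r ∸ 1 < μ r
        last<μ = ≤-reflexive 1+last≡μ

      count-from : ∀ d {r} → r + d ≡ m → μ w + d ≤ countBelow (μ r) C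
      count-from zero {r} r+0≡m = begin
        μ w + 0             ≡⟨ +-identityʳ _ ⟩
        μ w                 ≡⟨ countBelow-all (μ w) row-w ⟨
        countBelow (μ w) C  ≤⟨ countBelow-monoˡ C (μ-antitone r≤w) ⟩
        countBelow (μ r) C  ∎
        where r≤w = ≤-trans (≤-reflexive (trans (sym (+-identityʳ r)) r+0≡m)) (m⊓n≤m w K)
      count-from (suc d) {r} r+1+d≡m = begin
        μ w + suc d                     ≡⟨ +-suc _ d ⟩
        suc (μ w + d)                   ≤⟨ s≤s (count-from d (trans (sym (+-suc r d)) r+1+d≡m)) ⟩
        suc (countBelow (μ (suc r)) C)  ≤⟨ s≤s (countBelow-monoˡ C (flatten-strict (part l) r)) ⟩
        suc (countBelow (μ r ∸ 1) C)    ≡⟨ countBelow-suc-yes C (last-column r<m) ⟨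
        countBelow (suc (μ r ∸ 1)) C    ≡⟨ cong (λ x → countBelow x C) (m+[n∸m]≡n (μ-positive r<m)) ⟩
        countBelow (μ r) C              ∎
        where r<m = ≤-trans (s≤s (m≤m+n r d)) (≤-reflexive (trans (sym (+-suc r d)) r+1+d≡m))

    barPart≤ircont : barPart μ K (toℕ v) ≤ ircont l filling v
    barPart≤ircont = count-from m {0} refl

  barSize≤ircontSize : barSize (suc n) l ≤ ircontSize (suc n) l filling
  barSize≤ircontSize = begin
    barSize (suc n) l                   ≡⟨ barSize≡sum-barPart (suc n) l ⟩
    sumTo (suc n) (barPart μ K)         ≡⟨ sumFin-toℕ (suc n) (barPart μ K) ⟨
    sumFin (suc n) (barPart μ K ∘ toℕ)  ≤⟨ sumFin-mono (suc n) barPart≤ircont ⟩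
    ircontSize (suc n) l filling        ∎

linked⇒decreasing : ∀ {l} → Linked.Linked (λ a b → b ≤ a) l → Decreasing (part l)
linked⇒decreasing Linked.[]             _       = z≤n
linked⇒decreasing Linked.[-]            _       = z≤n
linked⇒decreasing (b≤a Linked.∷ _)     zero    = b≤a
linked⇒decreasing (_   Linked.∷ rest)  (suc i) = linked⇒decreasing rest i

corollary4p8 : (λ′ : List ℕ) → IsPartition λ′ → (n : ℕ) → 1 ≤ n →
    IsXDegreeOfG n λ′ (barSize n λ′)
corollary4p8 λ′ (linked , _) (suc n) _ =
    (λ φ φ-svrpp → ircontSize≤barSize (suc n) λ′ φ dec φ-svrpp)
  , (filling , filling-svrpp ,
     ≤-antisym (ircontSize≤barSize (suc n) λ′ filling dec filling-svrpp) barSize≤ircontSize)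
  where
  dec = linked⇒decreasing linked
  open FlatFilling n λ′
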